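{- Let $G$ be a connected triangle-free and quadrangle-free graph with $n$ vertices, $m$ edges and radius $r$. Then \[ C(G)\le\frac{n(2n-r)+4m}{8}, \] with equality if $G$ is a Moore graph of diameter $2$ or $G$ is the cycle $C_6$ of length $6$.
   Context: All graphs are finite and simple. A graph is triangle-free and quadrangle-free if it contains no cycle of length $3$ and no cycle of length $4$. For vertices $i,j$ of a connected graph $G$, $d(i,j)$ is their distance; the eccentricity of $v$ is $e(v)=\max_w d(v,w)$ and the radius is $r=\min_v e(v)$. The closeness is $C(G)=\sum_{i\in V(G)}\sum_{j\neq i}2^{ -d(i,j)}$. A Moore graph of diameter $2$ is a $k$-regular graph of diameter $2$ with exactly $k^2+1$ vertices (equivalently, a regular graph of diameter $2$ and girth $5$); examples are the pentagon $C_5$ and the Petersen graph. -}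

module Defs where

open import Data.Nat as ℕ using (ℕ; zero; suc; _≤_; _<ᵇ_; _⊔_; _*_; _+_)
open import Data.Fin using (Fin; toℕ; fromℕ<)
open import Data.Fin.Properties using (_≟_)
open import Data.Bool using (Bool; true; false; _∧_; _∨_; if_then_else_)
open import Data.List using (List; []; _∷_; map; foldr; concatMap; allFin)
open import Data.Nat.ListAction using (sum)
open import Data.Integer using (+_)
open import Data.Rational as ℚ using (ℚ; ½; 1ℚ; 0ℚ)
open import Data.Product using (Σ; _×_; ∃; ∃-syntax; _,_)
open import Data.Empty using (⊥)
open import Relation.Nullary using (¬_; does)
open import Relation.Binary.PropositionalEquality using (_≡_; _≢_)
open import Function.Bundles using (_↔_; Inverse)

record Graph (n : ℕ) : Set where
  field
    adj   : Fin n → Fin n → Bool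
    sym   : ∀ i j → adj i j ≡ adj j i
    irefl : ∀ i → adj i i ≡ false
open Graph public

Adj : ∀ {n} → Graph n → Fin n → Fin n → Set
Adj G i j = adj G i j ≡ true

data Walk {n : ℕ} (G : Graph n) : Fin n → Fin n → ℕ → Set where
  here : ∀ i → Walk G i i zero
  step : ∀ {i j k ℓ} → Adj G i j → Walk G j k ℓ → Walk G i k (suc ℓ)

Connected : ∀ {n} → Graph n → Set
Connected {n} G = (1 ≤ n) × (∀ i j → ∃[ ℓ ] Walk G i j ℓ)

IsDistance : ∀ {n} → Graph n → (Fin n → Fin n → ℕ) → Set
IsDistance G d = ∀ i j → Walk G i j (d i j) × (∀ ℓ → Walk G i j ℓ → d i j ≤ ℓ)

TriangleFree : ∀ {n} → Graph n → Set
TriangleFree G = ∀ a b c → Adj G a b → Adj G b c → Adj G c a → ⊥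

-- No cycle of length 4 (a,b,c,d distinct; the remaining inequalities
-- follow from irreflexivity).
QuadrangleFree : ∀ {n} → Graph n → Set
QuadrangleFree G = ∀ a b c d → a ≢ c → b ≢ d →
  Adj G a b → Adj G b c → Adj G c d → Adj G d a → ⊥

pairs : (n : ℕ) → List (Fin n × Fin n)
pairs n = concatMap (λ i → map (λ j → (i , j)) (allFin n)) (allFin n)

b2n : Bool → ℕ
b2n true  = 1
b2n false = 0

edgeCount : ∀ {n} → Graph n → ℕ
edgeCount {n} G =
  sum (map (λ { (i , j) → b2n ((toℕ i <ᵇ toℕ j) ∧ adj G i j) }) (pairs n))

degree : ∀ {n} → Graph n → Fin n → ℕ
degree {n} G v = sum (map (λ j → b2n (adj G v j)) (allFin n))

ecc : ∀ {n} → (Fin n → Fin n → ℕ) → Fin n → ℕ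
ecc {n} d v = foldr _⊔_ 0 (map (d v) (allFin n))

IsRadius : ∀ {n} → (Fin n → Fin n → ℕ) → ℕ → Set
IsRadius d r = (∃[ v ] ecc d v ≡ r) × (∀ v → r ≤ ecc d v)

halfPow : ℕ → ℚ
halfPow zero    = 1ℚ
halfPow (suc k) = ½ ℚ.* halfPow k

sumℚ : List ℚ → ℚ
sumℚ = foldr ℚ._+_ 0ℚ

closeness : ∀ {n} → (Fin n → Fin n → ℕ) → ℚ
closeness {n} d =
  sumℚ (map (λ { (i , j) → if does (i ≟ j) then 0ℚ else halfPow (d i j) }) (pairs n))

ℕtoℚ : ℕ → ℚ
ℕtoℚ k = + k ℚ./ 1

IsMooreDiam2 : ∀ {n} → Graph n → (Fin n → Fin n → ℕ) → Set
IsMooreDiam2 {n} G d =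
  ∃[ k ] ((∀ v → degree G v ≡ k) × (n ≡ k * k + 1) ×
          (∀ i j → d i j ≤ 2) × (∃[ i ] ∃[ j ] d i j ≡ 2))

C6adj : Fin 6 → Fin 6 → Bool
C6adj i j = ((suc (toℕ i) ℕ.% 6) ℕ.≡ᵇ toℕ j) ∨ ((suc (toℕ j) ℕ.% 6) ℕ.≡ᵇ toℕ i)

IsC6 : ∀ {n} → Graph n → Set
IsC6 {n} G = Σ (Fin n ↔ Fin 6) λ f →
  ∀ i j → adj G i j ≡ C6adj (Inverse.to f i) (Inverse.to f j)

oneEighth : ℚ
oneEighth = + 1 ℚ./ 8

-- Put weight 0 = 0, weight 1 = 4, weight 2 = 2 and weight k = 1 for k ≥ 3, so that
-- 2⁻ᵏ ≤ weight k / 8 for k ≥ 1, with equality for k ≤ 3.  For every k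
--   weight k + [k ≥ 3] + 2 [k = 0] = 2 + 2 [k = 1],
-- and summing this over the vertices j gives, for each vertex v,
--   Σⱼ weight (d v j) + #{j : d v j ≥ 3} + 2 = 2n + 2 deg v.
-- Every distance up to e(v) occurs along a shortest walk from v, so e(v) ≤ #{j : d v j ≥ 3} + 2,
-- and r ≤ e(v).  Summing over v and using Σ deg = 2m gives 8 C(G) ≤ n(2n − r) + 4m.
-- Equality holds when the diameter is ≤ 3 and #{j : d v j ≥ 3} = r − 2 for every v: a Moore graph of
-- diameter 2 has r = 2 and no vertex at distance 3, and in C₆ every vertex has one antipode and r = 3.
module Submission where

open import Defs hiding (sym)
open import Data.Nat using (ℕ)
open import Data.Fin using (Fin)
open import Data.Product using (_×_; _,_)
open import Data.Sum using (_⊎_; inj₁; inj₂)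
open import Relation.Binary.PropositionalEquality using (_≡_)

module _ where
  open import Function using (_∘_; case_of_)
  open import Function.Bundles using (Inverse; mk⇔)
  open import Data.Nat
    using (zero; suc; z≤n; s≤s; z<s; _+_; _*_; _∸_; _≤_; _<_; _⊔_; _⊓_; _≤ᵇ_; _<ᵇ_; _≡ᵇ_; ∣_-_∣)
  open import Data.Nat.Properties hiding (_≟_)
  open import Data.Nat.Properties using () renaming (_≟_ to _≟ℕ_)
  open import Data.Nat.DivMod using (m%n<n)
  open import Data.Nat.ListAction using (sum)
  open import Data.Nat.ListAction.Properties using (sum-++)
  import Data.Integer as ℤ
  import Data.Integer.Properties as ℤ
  open import Data.Rational as ℚ using (ℚ; mkℚ; 0ℚ; 1ℚ; ½)
  import Data.Rational.Properties as ℚ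
  open import Data.Rational.Solver using (module +-*-Solver)
  import Data.Nat.Coprimality as Coprime
  open import Data.Fin using (zero; suc; toℕ; fromℕ<)
  open import Data.Fin.Properties using (_≟_; toℕ-injective; all?; any?)
  open import Data.Bool using (true; false; T; _∧_; if_then_else_)
  import Data.Bool.Properties as Bool
  open import Data.List using (List; []; _∷_; _++_; map; foldr; concatMap; allFin; length)
  open import Data.List.Properties using (map-cong; map-∘; map-++; map-tabulate; length-tabulate)
  open import Data.List.Membership.Propositional using (_∈_)
  open import Data.List.Membership.Propositional.Properties using (∈-map⁺; ∈-map⁻; ∈-allFin)
  open import Data.List.Relation.Unary.Any using (here; there)
  open import Data.Product using (∃-syntax; proj₁; proj₂)
  open import Data.Empty using (⊥-elim)
  open import Relation.Nullary using (¬_; does; yes; no)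
  open import Relation.Nullary.Decidable using (dec-true; dec-false; does-⇔; from-yes; _×-dec_; _→-dec_)
  open import Relation.Binary.Definitions using (tri<; tri≈; tri>)
  open import Relation.Binary.PropositionalEquality
    using (_≢_; refl; sym; trans; cong; cong₂; subst; subst₂; module ≡-Reasoning)
  open import Algebra.Properties.CommutativeSemigroup +-commutativeSemigroup using (interchange)

  -- Sums and maxima over lists

  module _ {A : Set} where

    sum-map-cong : ∀ {f g : A → ℕ} → (∀ x → f x ≡ g x) → ∀ xs → sum (map f xs) ≡ sum (map g xs)
    sum-map-cong f≗g xs = cong sum (map-cong f≗g xs)

    sum-map-+ : ∀ (f g : A → ℕ) xs → sum (map (λ x → f x + g x) xs) ≡ sum (map f xs) + sum (map g xs)
    sum-map-+ f g []       = refl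
    sum-map-+ f g (x ∷ xs) =
      trans (cong ((f x + g x) +_) (sum-map-+ f g xs)) (interchange (f x) (g x) _ _)

    sum-map-*ˡ : ∀ c (f : A → ℕ) xs → sum (map (λ x → c * f x) xs) ≡ c * sum (map f xs)
    sum-map-*ˡ c f []       = sym (*-zeroʳ c)
    sum-map-*ˡ c f (x ∷ xs) =
      trans (cong (c * f x +_) (sum-map-*ˡ c f xs)) (sym (*-distribˡ-+ c (f x) _))

    sum-map-const : ∀ c (xs : List A) → sum (map (λ _ → c) xs) ≡ length xs * c
    sum-map-const c []       = refl
    sum-map-const c (x ∷ xs) = cong (c +_) (sum-map-const c xs)

    sum-map-mono : ∀ {f g : A → ℕ} → (∀ x → f x ≤ g x) → ∀ xs → sum (map f xs) ≤ sum (map g xs)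
    sum-map-mono f≤g []       = z≤n
    sum-map-mono f≤g (x ∷ xs) = +-mono-≤ (f≤g x) (sum-map-mono f≤g xs)

    ≤-sum-map : ∀ (f : A → ℕ) {x xs} → x ∈ xs → f x ≤ sum (map f xs)
    ≤-sum-map f (here refl) = m≤m+n (f _) _
    ≤-sum-map f {xs = y ∷ _} (there x∈xs) = ≤-trans (≤-sum-map f x∈xs) (m≤n+m _ (f y))

  module _ {A B : Set} where

    sum-map-concatMap : ∀ (f : B → ℕ) (g : A → List B) xs →
      sum (map f (concatMap g xs)) ≡ sum (map (λ x → sum (map f (g x))) xs)
    sum-map-concatMap f g []       = refl
    sum-map-concatMap f g (x ∷ xs) = begin
      sum (map f (g x ++ concatMap g xs))               ≡⟨ cong sum (map-++ f (g x) _) ⟩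
      sum (map f (g x) ++ map f (concatMap g xs))       ≡⟨ sum-++ (map f (g x)) _ ⟩
      sum (map f (g x)) + sum (map f (concatMap g xs))  ≡⟨ cong (_ +_) (sum-map-concatMap f g xs) ⟩
      sum (map f (g x)) + sum (map (λ x → sum (map f (g x))) xs)
                                                        ∎
      where open ≡-Reasoning

    sum-map-swap : ∀ (h : A → B → ℕ) xs ys →
      sum (map (λ x → sum (map (h x) ys)) xs) ≡ sum (map (λ y → sum (map (λ x → h x y) xs)) ys)
    sum-map-swap h []       ys = sym (trans (sum-map-const 0 ys) (*-zeroʳ (length ys)))
    sum-map-swap h (x ∷ xs) ys = trans (cong (sum (map (h x) ys) +_) (sum-map-swap h xs ys))
      (sym (sum-map-+ (h x) (λ y → sum (map (λ x → h x y) xs)) ys))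

  max : List ℕ → ℕ
  max = foldr _⊔_ 0

  ≤-max : ∀ {x xs} → x ∈ xs → x ≤ max xs
  ≤-max {xs = y ∷ _}  (here refl)  = m≤m⊔n y _
  ≤-max {xs = y ∷ xs} (there x∈xs) = ≤-trans (≤-max x∈xs) (m≤n⊔m y (max xs))

  max-≤ : ∀ {b} xs → (∀ {x} → x ∈ xs → x ≤ b) → max xs ≤ b
  max-≤ []       ≤b = z≤n
  max-≤ (x ∷ xs) ≤b = ⊔-lub (≤b (here refl)) (max-≤ xs (≤b ∘ there))

  max-attained : ∀ xs → max xs ≡ 0 ⊎ max xs ∈ xs
  max-attained []       = inj₁ refl
  max-attained (x ∷ xs) with ⊔-sel x (max xs) | max-attained xs
  ... | inj₁ ≡x | _             = inj₂ (here ≡x)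
  ... | inj₂ ≡m | inj₁ m≡0      = inj₁ (trans ≡m m≡0)
  ... | inj₂ ≡m | inj₂ m∈xs     = inj₂ (subst (_∈ x ∷ xs) (sym ≡m) (there m∈xs))

  -- Sums over Fin n

  ∑ : ∀ {n} → (Fin n → ℕ) → ℕ
  ∑ {n} f = sum (map f (allFin n))

  ∑-const : ∀ n c → ∑ {n} (λ _ → c) ≡ n * c
  ∑-const n c = trans (sum-map-const c (allFin n)) (cong (_* c) (length-tabulate {n = n} (λ i → i)))

  ∑-suc : ∀ {n} (f : Fin (suc n) → ℕ) → ∑ f ≡ f zero + ∑ (f ∘ suc)
  ∑-suc {n} f = cong (f zero +_)
    (cong sum (trans (map-tabulate suc f) (sym (map-tabulate (λ i → i) (f ∘ suc)))))

  ∑-δ : ∀ {n} (v : Fin n) → ∑ (λ j → b2n (does (v ≟ j))) ≡ 1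
  ∑-δ {suc n} zero    = trans (∑-suc {n} (λ j → b2n (does (zero ≟ j))))
    (cong suc (trans (sum-map-cong {g = λ _ → 0} (λ _ → refl) (allFin n)) (trans (∑-const n 0) (*-zeroʳ n))))
  ∑-δ {suc n} (suc v) = trans (∑-suc {n} (λ j → b2n (does (suc v ≟ j)))) (∑-δ v)

  sum-pairs : ∀ {n} (F : Fin n × Fin n → ℕ) → sum (map F (pairs n)) ≡ ∑ λ i → ∑ λ j → F (i , j)
  sum-pairs {n} F = trans (sum-map-concatMap F _ (allFin n))
    (sum-map-cong (λ i → cong sum (sym (map-∘ (allFin n)))) (allFin n))

  b2n-T : ∀ {b} → T b → b2n b ≡ 1
  b2n-T {true} _ = refl

  count-≥ : ∀ {n} (f : Fin n → ℕ) t s → (∀ k → k ≤ t + s → ∃[ x ] f x ≡ k) →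
            suc s ≤ ∑ (λ x → b2n (t ≤ᵇ f x))
  count-≥ {n} f t s attained = begin
    1 + s                                                     ≤⟨ +-mono-≤ hit-t (rest s attained) ⟩
    ∑ (λ x → b2n (f x ≡ᵇ t)) + ∑ (λ x → b2n (suc t ≤ᵇ f x))   ≡⟨ sum-map-+ _ _ (allFin n) ⟨
    ∑ (λ x → b2n (f x ≡ᵇ t) + b2n (suc t ≤ᵇ f x))
                                  ≡⟨ sum-map-cong (≤ᵇ-split t ∘ f) (allFin n) ⟨
    ∑ (λ x → b2n (t ≤ᵇ f x))                                  ∎
    where
    open ≤-Reasoning

    ≤ᵇ-split : ∀ t k → b2n (t ≤ᵇ k) ≡ b2n (k ≡ᵇ t) + b2n (suc t ≤ᵇ k)
    ≤ᵇ-split zero          zero    = refl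
    ≤ᵇ-split zero          (suc k) = refl
    ≤ᵇ-split (suc t)       zero    = refl
    ≤ᵇ-split (suc zero)    (suc k) = ≤ᵇ-split zero k
    ≤ᵇ-split (suc (suc t)) (suc k) = ≤ᵇ-split (suc t) k

    hit-t : 1 ≤ ∑ (λ x → b2n (f x ≡ᵇ t))
    hit-t with x , fx≡t ← attained t (m≤m+n t s) =
      subst (_≤ _) (b2n-T (≡⇒≡ᵇ (f x) t fx≡t)) (≤-sum-map (λ x → b2n (f x ≡ᵇ t)) (∈-allFin x))

    rest : ∀ s → (∀ k → k ≤ t + s → ∃[ x ] f x ≡ k) → s ≤ ∑ (λ x → b2n (suc t ≤ᵇ f x))
    rest zero    _        = z≤n
    rest (suc s) attained = count-≥ f (suc t) s (λ k k≤ → attained k (subst (k ≤_) (sym (+-suc t s)) k≤))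

  -- Rational arithmetic

  ℕtoℚ≡mkℚ : ∀ k → ℕtoℚ k ≡ mkℚ (ℤ.+ k) 0 (Coprime.sym (Coprime.1-coprimeTo k))
  ℕtoℚ≡mkℚ k = ℚ.normalize-coprime (Coprime.sym (Coprime.1-coprimeTo k))

  ℕtoℚ-+ : ∀ a b → ℕtoℚ (a + b) ≡ ℕtoℚ a ℚ.+ ℕtoℚ b
  ℕtoℚ-+ a b rewrite ℕtoℚ≡mkℚ a | ℕtoℚ≡mkℚ b =
    ℚ./-cong (sym (cong₂ ℤ._+_ (ℤ.*-identityʳ (ℤ.+ a)) (ℤ.*-identityʳ (ℤ.+ b)))) refl

  ℕtoℚ-* : ∀ a b → ℕtoℚ (a * b) ≡ ℕtoℚ a ℚ.* ℕtoℚ b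
  ℕtoℚ-* a b rewrite ℕtoℚ≡mkℚ a | ℕtoℚ≡mkℚ b = ℚ./-cong (ℤ.pos-* a b) refl

  ℕtoℚ-mono : ∀ {a b} → a ≤ b → ℕtoℚ a ℚ.≤ ℕtoℚ b
  ℕtoℚ-mono {a} {b} a≤b rewrite ℕtoℚ≡mkℚ a | ℕtoℚ≡mkℚ b =
    ℚ.*≤* (ℤ.*-monoʳ-≤-nonNeg (ℤ.+ 1) (ℤ.+≤+ a≤b))

  ℕtoℚ-+-∸ : ∀ a b → ℕtoℚ (a + b) ℚ.- ℕtoℚ b ≡ ℕtoℚ a
  ℕtoℚ-+-∸ a b = trans (cong (ℚ._- ℕtoℚ b) (ℕtoℚ-+ a b))
                       (solve 2 (λ x y → x :+ y :- y := x) refl (ℕtoℚ a) (ℕtoℚ b))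
    where open +-*-Solver

  closenessBound : ℕ → ℕ → ℕ → ℚ
  closenessBound n r m =
    (ℕtoℚ n ℚ.* (ℕtoℚ 2 ℚ.* ℕtoℚ n ℚ.- ℕtoℚ r) ℚ.+ ℕtoℚ 4 ℚ.* ℕtoℚ m) ℚ.* oneEighth

  closenessBound-ℕ : ∀ n r m →
    closenessBound n r m ≡ (ℕtoℚ (2 * n * n + 4 * m) ℚ.- ℕtoℚ (n * r)) ℚ.* oneEighth
  closenessBound-ℕ n r m = cong (ℚ._* oneEighth) (begin
    N ℚ.* (ℕtoℚ 2 ℚ.* N ℚ.- R) ℚ.+ ℕtoℚ 4 ℚ.* M
      ≡⟨ solve 3 (λ N R M → N :* (con (ℕtoℚ 2) :* N :- R) :+ con (ℕtoℚ 4) :* M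
                         := (con (ℕtoℚ 2) :* N :* N :+ con (ℕtoℚ 4) :* M) :- N :* R) refl N R M ⟩
    ℕtoℚ 2 ℚ.* N ℚ.* N ℚ.+ ℕtoℚ 4 ℚ.* M ℚ.- N ℚ.* R
      ≡⟨ cong₂ ℚ._-_ (trans (ℕtoℚ-+ (2 * n * n) (4 * m))
                       (cong₂ ℚ._+_ (trans (ℕtoℚ-* (2 * n) n) (cong (ℚ._* N) (ℕtoℚ-* 2 n))) (ℕtoℚ-* 4 m)))
                     (ℕtoℚ-* n r) ⟨
    ℕtoℚ (2 * n * n + 4 * m) ℚ.- ℕtoℚ (n * r)
      ∎)
    where
    open ≡-Reasoning
    open +-*-Solver
    N = ℕtoℚ n
    R = ℕtoℚ r
    M = ℕtoℚ m

  ≤-closenessBound : ∀ {w n r m} → w + n * r ≤ 2 * n * n + 4 * m →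
                     ℕtoℚ w ℚ.* oneEighth ℚ.≤ closenessBound n r m
  ≤-closenessBound {w} {n} {r} {m} le = begin
    ℕtoℚ w ℚ.* oneEighth
      ≡⟨ cong (ℚ._* oneEighth) (ℕtoℚ-+-∸ w (n * r)) ⟨
    (ℕtoℚ (w + n * r) ℚ.- ℕtoℚ (n * r)) ℚ.* oneEighth
      ≤⟨ ℚ.*-monoʳ-≤-nonNeg oneEighth (ℚ.+-monoˡ-≤ _ (ℕtoℚ-mono le)) ⟩
    (ℕtoℚ (2 * n * n + 4 * m) ℚ.- ℕtoℚ (n * r)) ℚ.* oneEighth
      ≡⟨ closenessBound-ℕ n r m ⟨
    closenessBound n r m
      ∎
    where open ℚ.≤-Reasoning

  ≡-closenessBound : ∀ {w n r m} → w + n * r ≡ 2 * n * n + 4 * m →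
                     ℕtoℚ w ℚ.* oneEighth ≡ closenessBound n r m
  ≡-closenessBound {w} {n} {r} {m} eq = begin
    ℕtoℚ w ℚ.* oneEighth
      ≡⟨ cong (ℚ._* oneEighth) (ℕtoℚ-+-∸ w (n * r)) ⟨
    (ℕtoℚ (w + n * r) ℚ.- ℕtoℚ (n * r)) ℚ.* oneEighth
      ≡⟨ cong (λ x → (ℕtoℚ x ℚ.- ℕtoℚ (n * r)) ℚ.* oneEighth) eq ⟩
    (ℕtoℚ (2 * n * n + 4 * m) ℚ.- ℕtoℚ (n * r)) ℚ.* oneEighth
      ≡⟨ closenessBound-ℕ n r m ⟨
    closenessBound n r m
      ∎
    where open ≡-Reasoning

  module _ {A : Set} where

    sumℚ-mono : ∀ {f g : A → ℚ} → (∀ x → f x ℚ.≤ g x) → ∀ xs →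
                sumℚ (map f xs) ℚ.≤ sumℚ (map g xs)
    sumℚ-mono f≤g []       = ℚ.≤-refl
    sumℚ-mono f≤g (x ∷ xs) = ℚ.+-mono-≤ (f≤g x) (sumℚ-mono f≤g xs)

    sumℚ-ℕtoℚ-* : ∀ (f : A → ℕ) q xs →
                  sumℚ (map (λ x → ℕtoℚ (f x) ℚ.* q) xs) ≡ ℕtoℚ (sum (map f xs)) ℚ.* q
    sumℚ-ℕtoℚ-* f q []       = sym (ℚ.*-zeroˡ q)
    sumℚ-ℕtoℚ-* f q (x ∷ xs) = begin
      ℕtoℚ (f x) ℚ.* q ℚ.+ sumℚ (map (λ x → ℕtoℚ (f x) ℚ.* q) xs)
        ≡⟨ cong (ℕtoℚ (f x) ℚ.* q ℚ.+_) (sumℚ-ℕtoℚ-* f q xs) ⟩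
      ℕtoℚ (f x) ℚ.* q ℚ.+ ℕtoℚ (sum (map f xs)) ℚ.* q
        ≡⟨ ℚ.*-distribʳ-+ q (ℕtoℚ (f x)) (ℕtoℚ (sum (map f xs))) ⟨
      (ℕtoℚ (f x) ℚ.+ ℕtoℚ (sum (map f xs))) ℚ.* q
        ≡⟨ cong (ℚ._* q) (ℕtoℚ-+ (f x) _) ⟨
      ℕtoℚ (f x + sum (map f xs)) ℚ.* q
        ∎
      where open ≡-Reasoning

  -- The weight of a distance

  weight : ℕ → ℕ
  weight 0                   = 0
  weight 1                   = 4
  weight 2                   = 2
  weight (suc (suc (suc _))) = 1

  weight-identity : ∀ k → weight k + b2n (3 ≤ᵇ k) + 2 * b2n (k ≡ᵇ 0) ≡ 2 + 2 * b2n (k ≡ᵇ 1)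
  weight-identity 0                   = refl
  weight-identity 1                   = refl
  weight-identity 2                   = refl
  weight-identity (suc (suc (suc _))) = refl

  halfPow-≤-1 : ∀ k → halfPow k ℚ.≤ 1ℚ
  halfPow-≤-1 zero    = ℚ.≤-refl
  halfPow-≤-1 (suc k) = ℚ.≤-trans (ℚ.*-monoˡ-≤-nonNeg ½ (halfPow-≤-1 k)) (from-yes (½ ℚ.≤? 1ℚ))

  halfPow-+-≤ : ∀ k m → halfPow (k + m) ℚ.≤ halfPow k
  halfPow-+-≤ zero    m = halfPow-≤-1 m
  halfPow-+-≤ (suc k) m = ℚ.*-monoˡ-≤-nonNeg ½ (halfPow-+-≤ k m)

  halfPow-≤-weight : ∀ k → k ≢ 0 → halfPow k ℚ.≤ ℕtoℚ (weight k) ℚ.* oneEighth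
  halfPow-≤-weight zero                k≢0 = ⊥-elim (k≢0 refl)
  halfPow-≤-weight 1                   _   = ℚ.≤-refl
  halfPow-≤-weight 2                   _   = ℚ.≤-refl
  halfPow-≤-weight (suc (suc (suc m))) _   = halfPow-+-≤ 3 m

  halfPow≡weight : ∀ k → k ≢ 0 → k ≤ 3 → halfPow k ≡ ℕtoℚ (weight k) ℚ.* oneEighth
  halfPow≡weight zero k≢0 _                             = ⊥-elim (k≢0 refl)
  halfPow≡weight 1    _   _                             = refl
  halfPow≡weight 2    _   _                             = refl
  halfPow≡weight 3    _   _                             = refl
  halfPow≡weight (suc (suc (suc (suc _)))) _ (s≤s (s≤s (s≤s ())))

  -- Walks and distances

  module _ {n} {G : Graph n} where

    walk-++ : ∀ {i j k a b} → Walk G i j a → Walk G j k b → Walk G i k (a + b)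
    walk-++ (here _)   w′ = w′
    walk-++ (step e w) w′ = step e (walk-++ w w′)

    walk-split : ∀ a {b i k} → Walk G i k (a + b) → ∃[ x ] Walk G i x a × Walk G x k b
    walk-split zero    w          = _ , here _ , w
    walk-split (suc a) (step e w) with x , w₁ , w₂ ← walk-split a w = x , step e w₁ , w₂

    walk₀-≡ : ∀ {i j} → Walk G i j 0 → i ≡ j
    walk₀-≡ (here _) = refl

    walk₁-Adj : ∀ {i j} → Walk G i j 1 → Adj G i j
    walk₁-Adj (step e (here _)) = e

    Adj-irrefl : ∀ {i j} → Adj G i j → i ≢ j
    Adj-irrefl {i} e refl = case trans (sym e) (irefl G i) of λ ()

  vertexWeight : ∀ {n} → (Fin n → Fin n → ℕ) → Fin n → ℕ
  vertexWeight d v = ∑ (λ j → weight (d v j))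

  weightSum : ∀ {n} → (Fin n → Fin n → ℕ) → ℕ
  weightSum d = ∑ (vertexWeight d)

  farCount : ∀ {n} → (Fin n → Fin n → ℕ) → Fin n → ℕ
  farCount d v = ∑ (λ j → b2n (3 ≤ᵇ d v j))

  module _ {n} (G : Graph n) where
    private
      edge< : Fin n → Fin n → ℕ
      edge< i j = b2n ((toℕ i <ᵇ toℕ j) ∧ adj G i j)

      <ᵇ-true : ∀ {a b} → a < b → (a <ᵇ b) ≡ true
      <ᵇ-true {a} {b} = dec-true (a <? b)

      <ᵇ-false : ∀ {a b} → ¬ a < b → (a <ᵇ b) ≡ false
      <ᵇ-false {a} {b} = dec-false (a <? b)

    adj-split : ∀ i j → b2n (adj G i j) ≡ edge< i j + edge< j i
    adj-split i j with <-cmp (toℕ i) (toℕ j)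
    ... | tri< i<j _ j≮i rewrite <ᵇ-true i<j | <ᵇ-false j≮i = sym (+-identityʳ _)
    ... | tri> i≮j _ j<i rewrite <ᵇ-false i≮j | <ᵇ-true j<i = cong b2n (Graph.sym G i j)
    ... | tri≈ i≮i i≡j _ with refl ← toℕ-injective i≡j rewrite <ᵇ-false i≮i | irefl G i = refl

    handshake : ∑ (degree G) ≡ 2 * edgeCount G
    handshake = begin
      ∑ (λ i → ∑ (λ j → b2n (adj G i j)))
        ≡⟨ sum-map-cong (λ i → trans (sum-map-cong (adj-split i) (allFin n)) (sum-map-+ _ _ (allFin n)))
                        (allFin n) ⟩
      ∑ (λ i → ∑ (edge< i) + ∑ (λ j → edge< j i))
        ≡⟨ sum-map-+ _ _ (allFin n) ⟩
      X + ∑ (λ i → ∑ (λ j → edge< j i))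
        ≡⟨ cong (X +_) (sum-map-swap edge< (allFin n) (allFin n)) ⟨
      X + X
        ≡⟨ cong (X +_) (+-identityʳ X) ⟨
      2 * X
        ≡⟨ cong (2 *_) (sum-pairs {n} _) ⟨
      2 * edgeCount G
        ∎
      where
      open ≡-Reasoning
      X = ∑ λ i → ∑ (edge< i)

  EqualityCase : ∀ {n} → (Fin n → Fin n → ℕ) → ℕ → Set
  EqualityCase d r = (∀ i j → d i j ≤ 3) × (∀ v → farCount d v + 2 ≡ r)

  module Distances {n} {G : Graph n} {d : Fin n → Fin n → ℕ} (isDistance : IsDistance G d) where

    d-walk : ∀ i j → Walk G i j (d i j)
    d-walk i j = proj₁ (isDistance i j)

    d-≤-walk : ∀ {i j ℓ} → Walk G i j ℓ → d i j ≤ ℓ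
    d-≤-walk {i} {j} = proj₂ (isDistance i j) _

    d-refl : ∀ v → d v v ≡ 0
    d-refl v = n≤0⇒n≡0 (d-≤-walk (here v))

    d≡0⇒≡ : ∀ {i j} → d i j ≡ 0 → i ≡ j
    d≡0⇒≡ {i} {j} eq = walk₀-≡ (subst (Walk G i j) eq (d-walk i j))

    d≡ᵇ0 : ∀ i j → (d i j ≡ᵇ 0) ≡ does (i ≟ j)
    d≡ᵇ0 i j with i ≟ j
    ... | yes refl rewrite d-refl i = refl
    ... | no  i≢j  = dec-false (d i j ≟ℕ 0) (i≢j ∘ d≡0⇒≡)

    d≡ᵇ1 : ∀ i j → (d i j ≡ᵇ 1) ≡ adj G i j
    d≡ᵇ1 i j with adj G i j in e
    ... | true  = dec-true (d i j ≟ℕ 1)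
                    (≤-antisym (d-≤-walk (step e (here j))) (n≢0⇒n>0 (Adj-irrefl {G = G} e ∘ d≡0⇒≡)))
    ... | false = dec-false (d i j ≟ℕ 1) λ d≡1 →
                    case trans (sym e) (walk₁-Adj (subst (Walk G i j) d≡1 (d-walk i j))) of λ ()

    d-intermediate : ∀ {v w k} → k ≤ d v w → ∃[ x ] d v x ≡ k
    d-intermediate {v} {w} {k} k≤d with s , k+s≡d ← m≤n⇒∃[o]m+o≡n k≤d
      with x , v⇝x , x⇝w ← walk-split k (subst (Walk G v w) (sym k+s≡d) (d-walk v w)) =
      x , ≤-antisym (d-≤-walk v⇝x) (+-cancelʳ-≤ s k (d v x) (begin
        k + s      ≡⟨ k+s≡d ⟩
        d v w      ≤⟨ d-≤-walk (walk-++ (d-walk v x) x⇝w) ⟩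
        d v x + s  ∎))
      where open ≤-Reasoning

    d-≤-ecc : ∀ v j → d v j ≤ ecc d v
    d-≤-ecc v j = ≤-max (∈-map⁺ (d v) (∈-allFin j))

    ecc-≤ : ∀ {v b} → (∀ j → d v j ≤ b) → ecc d v ≤ b
    ecc-≤ {v} ≤b = max-≤ (map (d v) (allFin n)) λ x∈ →
      let (j , _ , x≡dvj) = ∈-map⁻ (d v) x∈ in subst (_≤ _) (sym x≡dvj) (≤b j)

    ecc-intermediate : ∀ {v k} → k ≤ ecc d v → ∃[ x ] d v x ≡ k
    ecc-intermediate {v} {k} k≤ecc with max-attained (map (d v) (allFin n))
    ... | inj₁ ecc≡0 = v , trans (d-refl v) (sym (n≤0⇒n≡0 (subst (k ≤_) ecc≡0 k≤ecc)))
    ... | inj₂ ecc∈  with w , _ , ecc≡dvw ← ∈-map⁻ (d v) ecc∈ =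
      d-intermediate (subst (k ≤_) ecc≡dvw k≤ecc)

    ecc≤farCount+2 : ∀ v → ecc d v ≤ farCount d v + 2
    ecc≤farCount+2 v with 3 ≤? ecc d v
    ... | no  ecc≱3 = ≤-trans (≤-pred (≰⇒> ecc≱3)) (m≤n+m 2 _)
    ... | yes 3≤ecc with s , 3+s≡ecc ← m≤n⇒∃[o]m+o≡n 3≤ecc = begin
      ecc d v           ≡⟨ 3+s≡ecc ⟨
      3 + s             ≡⟨ +-comm 2 (suc s) ⟩
      suc s + 2         ≤⟨ +-monoˡ-≤ 2 (count-≥ (d v) 3 s λ k k≤ →
                             ecc-intermediate (subst (k ≤_) 3+s≡ecc k≤)) ⟩
      farCount d v + 2  ∎
      where open ≤-Reasoning

    vertex-identity : ∀ v → vertexWeight d v + farCount d v + 2 ≡ 2 * n + 2 * degree G v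
    vertex-identity v = begin
      vertexWeight d v + farCount d v + 2 * 1
        ≡⟨ cong (λ c → vertexWeight d v + farCount d v + 2 * c)
             (trans (sum-map-cong (λ j → cong b2n (d≡ᵇ0 v j)) (allFin n)) (∑-δ v)) ⟨
      vertexWeight d v + farCount d v + 2 * ∑ (λ j → b2n (d v j ≡ᵇ 0))
        ≡⟨ trans (sum-map-+ _ _ (allFin n)) (cong₂ _+_ (sum-map-+ _ _ (allFin n)) (sum-map-*ˡ 2 _ (allFin n))) ⟨
      ∑ (λ j → weight (d v j) + b2n (3 ≤ᵇ d v j) + 2 * b2n (d v j ≡ᵇ 0))
        ≡⟨ sum-map-cong (weight-identity ∘ d v) (allFin n) ⟩
      ∑ (λ j → 2 + 2 * b2n (d v j ≡ᵇ 1))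
        ≡⟨ trans (sum-map-+ (λ _ → 2) _ (allFin n))
                 (cong₂ _+_ (trans (∑-const n 2) (*-comm n 2)) (sum-map-*ˡ 2 _ (allFin n))) ⟩
      2 * n + 2 * ∑ (λ j → b2n (d v j ≡ᵇ 1))
        ≡⟨ cong (λ c → 2 * n + 2 * c) (sum-map-cong (λ j → cong b2n (d≡ᵇ1 v j)) (allFin n)) ⟩
      2 * n + 2 * degree G v
        ∎
      where open ≡-Reasoning

    ∑-vertexWeight+r : ∀ r → ∑ (λ v → vertexWeight d v + r) ≡ weightSum d + n * r
    ∑-vertexWeight+r r = trans (sum-map-+ (vertexWeight d) (λ _ → r) (allFin n)) (cong (weightSum d +_) (∑-const n r))

    ∑-2n+2deg : ∑ (λ v → 2 * n + 2 * degree G v) ≡ 2 * n * n + 4 * edgeCount G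
    ∑-2n+2deg = begin
      ∑ (λ v → 2 * n + 2 * degree G v)        ≡⟨ sum-map-+ (λ _ → 2 * n) _ (allFin n) ⟩
      ∑ {n} (λ _ → 2 * n) + ∑ (λ v → 2 * degree G v)
        ≡⟨ cong₂ _+_ (trans (∑-const n (2 * n)) (*-comm n (2 * n))) (sum-map-*ˡ 2 _ (allFin n)) ⟩
      2 * n * n + 2 * ∑ (degree G)            ≡⟨ cong (λ x → 2 * n * n + 2 * x) (handshake G) ⟩
      2 * n * n + 2 * (2 * edgeCount G)       ≡⟨ cong (2 * n * n +_) (*-assoc 2 2 (edgeCount G)) ⟨
      2 * n * n + 4 * edgeCount G             ∎
      where open ≡-Reasoning

    weightSum-bound : ∀ {r} → (∀ v → r ≤ ecc d v) → weightSum d + n * r ≤ 2 * n * n + 4 * edgeCount G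
    weightSum-bound {r} r≤ecc = subst₂ _≤_ (∑-vertexWeight+r r) ∑-2n+2deg (sum-map-mono vertex-bound (allFin n))
      where
      vertex-bound : ∀ v → vertexWeight d v + r ≤ 2 * n + 2 * degree G v
      vertex-bound v = begin
        vertexWeight d v + r                 ≤⟨ +-monoʳ-≤ _ (≤-trans (r≤ecc v) (ecc≤farCount+2 v)) ⟩
        vertexWeight d v + (farCount d v + 2) ≡⟨ +-assoc (vertexWeight d v) (farCount d v) 2 ⟨
        vertexWeight d v + farCount d v + 2  ≡⟨ vertex-identity v ⟩
        2 * n + 2 * degree G v               ∎
        where open ≤-Reasoning

    weightSum-exact : ∀ {r} → (∀ v → farCount d v + 2 ≡ r) → weightSum d + n * r ≡ 2 * n * n + 4 * edgeCount G
    weightSum-exact {r} far+2≡r = begin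
      weightSum d + n * r                   ≡⟨ ∑-vertexWeight+r r ⟨
      ∑ (λ v → vertexWeight d v + r)        ≡⟨ sum-map-cong vertex-exact (allFin n) ⟩
      ∑ (λ v → 2 * n + 2 * degree G v)      ≡⟨ ∑-2n+2deg ⟩
      2 * n * n + 4 * edgeCount G           ∎
      where
      open ≡-Reasoning
      vertex-exact : ∀ v → vertexWeight d v + r ≡ 2 * n + 2 * degree G v
      vertex-exact v = trans (cong (vertexWeight d v +_) (sym (far+2≡r v)))
                             (trans (sym (+-assoc (vertexWeight d v) (farCount d v) 2)) (vertex-identity v))

    closenessTerm-≤ : ∀ i j →
      (if does (i ≟ j) then 0ℚ else halfPow (d i j)) ℚ.≤ ℕtoℚ (weight (d i j)) ℚ.* oneEighth
    closenessTerm-≤ i j with i ≟ j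
    ... | yes refl rewrite d-refl i = ℚ.≤-refl
    ... | no  i≢j  = halfPow-≤-weight (d i j) (i≢j ∘ d≡0⇒≡)

    closenessTerm-≡ : (∀ i j → d i j ≤ 3) →
      ∀ i j → (if does (i ≟ j) then 0ℚ else halfPow (d i j)) ≡ ℕtoℚ (weight (d i j)) ℚ.* oneEighth
    closenessTerm-≡ d≤3 i j with i ≟ j
    ... | yes refl rewrite d-refl i = refl
    ... | no  i≢j  = halfPow≡weight (d i j) (i≢j ∘ d≡0⇒≡) (d≤3 i j)

    ℕtoℚ-weightSum : sumℚ (map (λ p → ℕtoℚ (weight (d (proj₁ p) (proj₂ p))) ℚ.* oneEighth) (pairs n))
                     ≡ ℕtoℚ (weightSum d) ℚ.* oneEighth
    ℕtoℚ-weightSum = trans (sumℚ-ℕtoℚ-* pairWeight oneEighth (pairs n))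
                           (cong (λ x → ℕtoℚ x ℚ.* oneEighth) (sum-pairs pairWeight))
      where
      pairWeight : Fin n × Fin n → ℕ
      pairWeight p = weight (d (proj₁ p) (proj₂ p))

    closeness-≤ : closeness d ℚ.≤ ℕtoℚ (weightSum d) ℚ.* oneEighth
    closeness-≤ = ℚ.≤-trans (sumℚ-mono (λ (i , j) → closenessTerm-≤ i j) (pairs n))
                            (ℚ.≤-reflexive ℕtoℚ-weightSum)

    closeness-≡ : (∀ i j → d i j ≤ 3) → closeness d ≡ ℕtoℚ (weightSum d) ℚ.* oneEighth
    closeness-≡ d≤3 = trans (cong sumℚ (map-cong (λ (i , j) → closenessTerm-≡ d≤3 i j) (pairs n)))
                            ℕtoℚ-weightSum

    closeness-≤-closenessBound : ∀ {r} → (∀ v → r ≤ ecc d v) →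
                                 closeness d ℚ.≤ closenessBound n r (edgeCount G)
    closeness-≤-closenessBound {r} r≤ecc =
      ℚ.≤-trans closeness-≤ (≤-closenessBound {n = n} {r = r} {m = edgeCount G} (weightSum-bound r≤ecc))

    closeness≡closenessBound : ∀ {r} → EqualityCase d r → closeness d ≡ closenessBound n r (edgeCount G)
    closeness≡closenessBound {r} (d≤3 , far+2≡r) =
      trans (closeness-≡ d≤3) (≡-closenessBound {n = n} {r = r} {m = edgeCount G} (weightSum-exact far+2≡r))

  -- Moore graphs of diameter 2

  distinct³⇒3≤n : ∀ {n} {a b c : Fin n} → a ≢ b → b ≢ c → a ≢ c → 3 ≤ n
  distinct³⇒3≤n {suc (suc (suc _))} _ _ _ = s≤s (s≤s (s≤s z≤n))
  distinct³⇒3≤n {1} {zero} {zero} a≢b _ _ = ⊥-elim (a≢b refl)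
  distinct³⇒3≤n {2} {zero}     {zero}               a≢b _ _ = ⊥-elim (a≢b refl)
  distinct³⇒3≤n {2} {suc zero} {suc zero}           a≢b _ _ = ⊥-elim (a≢b refl)
  distinct³⇒3≤n {2} {zero}     {suc zero} {zero}     _ _ a≢c = ⊥-elim (a≢c refl)
  distinct³⇒3≤n {2} {zero}     {suc zero} {suc zero} _ b≢c _ = ⊥-elim (b≢c refl)
  distinct³⇒3≤n {2} {suc zero} {zero}     {zero}     _ b≢c _ = ⊥-elim (b≢c refl)
  distinct³⇒3≤n {2} {suc zero} {zero}     {suc zero} _ _ a≢c = ⊥-elim (a≢c refl)

  square≡⇒≤1 : ∀ k → k ≡ k * k → k ≤ 1
  square≡⇒≤1 0             _    = z≤n
  square≡⇒≤1 1             _    = s≤s z≤n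
  square≡⇒≤1 (suc (suc k)) k≡k² = case +-cancelˡ-≡ (2 + k) 0 _ (trans (+-identityʳ _) k≡k²) of λ ()

  module _ {n} {G : Graph n} {d : Fin n → Fin n → ℕ} (isDistance : IsDistance G d) where
    open Distances isDistance

    degree+1≡n : ∀ {v} → (∀ j → d v j ≤ 1) → degree G v + 1 ≡ n
    degree+1≡n {v} d≤1 = begin
      degree G v + 1
        ≡⟨ cong₂ _+_ (sum-map-cong (λ j → cong b2n (d≡ᵇ1 v j)) (allFin n))
                     (trans (sum-map-cong (λ j → cong b2n (d≡ᵇ0 v j)) (allFin n)) (∑-δ v)) ⟨
      ∑ (λ j → b2n (d v j ≡ᵇ 1)) + ∑ (λ j → b2n (d v j ≡ᵇ 0))
        ≡⟨ sum-map-+ _ _ (allFin n) ⟨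
      ∑ (λ j → b2n (d v j ≡ᵇ 1) + b2n (d v j ≡ᵇ 0))
        ≡⟨ sum-map-cong (λ j → exactly-one (d≤1 j)) (allFin n) ⟩
      ∑ {n} (λ _ → 1)
        ≡⟨ trans (∑-const n 1) (*-identityʳ n) ⟩
      n ∎
      where
      open ≡-Reasoning
      exactly-one : ∀ {k} → k ≤ 1 → b2n (k ≡ᵇ 1) + b2n (k ≡ᵇ 0) ≡ 1
      exactly-one z≤n       = refl
      exactly-one (s≤s z≤n) = refl

    d≡2⇒3≤n : ∀ {i j} → d i j ≡ 2 → 3 ≤ n
    d≡2⇒3≤n {i} {j} dij≡2 with x , i⇝x , x⇝j ← walk-split 1 (subst (Walk G i j) dij≡2 (d-walk i j)) =
      distinct³⇒3≤n (Adj-irrefl {G = G} (walk₁-Adj i⇝x)) (Adj-irrefl {G = G} (walk₁-Adj x⇝j))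
        λ { refl → case trans (sym dij≡2) (d-refl i) of λ () }

    moore-equalityCase : ∀ {r} → IsRadius d r → IsMooreDiam2 G d → EqualityCase d r
    moore-equalityCase {r} ((v , ecc≡r) , _) (k , degree≡k , n≡k*k+1 , d≤2 , _ , _ , dij≡2) =
      (λ i j → m≤n⇒m≤1+n (d≤2 i j)) , λ w → trans (cong (_+ 2) (farCount≡0 w)) (sym r≡2)
      where
      farCount≡0 : ∀ w → farCount d w ≡ 0
      farCount≡0 w = trans (sum-map-cong (λ j → cong b2n (dec-false (3 ≤? d w j) (<⇒≱ (s≤s (d≤2 w j)))))
                                         (allFin n))
                           (trans (∑-const n 0) (*-zeroʳ n))

      -- a Moore graph whose centre is adjacent to every vertex is K₁ or K₂, which has no pair at distance 2
      ecc≰1 : ¬ ecc d v ≤ 1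
      ecc≰1 ecc≤1 =
        <⇒≱ (d≡2⇒3≤n dij≡2) (subst (_≤ 2) (sym n≡k+1) (+-monoˡ-≤ 1 (square≡⇒≤1 k k≡k*k)))
        where
        n≡k+1 : n ≡ k + 1
        n≡k+1 = trans (sym (degree+1≡n (λ j → ≤-trans (d-≤-ecc v j) ecc≤1))) (cong (_+ 1) (degree≡k v))
        k≡k*k : k ≡ k * k
        k≡k*k = +-cancelʳ-≡ 1 k (k * k) (trans (sym n≡k+1) n≡k*k+1)

      r≡2 : r ≡ 2
      r≡2 = trans (sym ecc≡r) (≤-antisym (ecc-≤ (d≤2 v)) (≰⇒> ecc≰1))

  -- The cycle C₆

  cycleDist : Fin 6 → Fin 6 → ℕ
  cycleDist a b = ∣ toℕ a - toℕ b ∣ ⊓ (6 ∸ ∣ toℕ a - toℕ b ∣)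

  antipode : Fin 6 → Fin 6
  antipode a = fromℕ< (m%n<n (3 + toℕ a) 6)

  cycleDist-refl : ∀ a → cycleDist a a ≡ 0
  cycleDist-refl = from-yes (all? λ a → cycleDist a a ≟ℕ 0)

  cycleDist≡0⇒≡ : ∀ a b → cycleDist a b ≡ 0 → a ≡ b
  cycleDist≡0⇒≡ = from-yes (all? λ a → all? λ b → cycleDist a b ≟ℕ 0 →-dec a ≟ b)

  cycleDist-step : ∀ a b c → C6adj a c ≡ true → cycleDist a b ≤ suc (cycleDist c b)
  cycleDist-step = from-yes (all? λ a → all? λ b → all? λ c →
    C6adj a c Bool.≟ true →-dec cycleDist a b ≤? suc (cycleDist c b))

  cycleDist-descent : ∀ a b → 0 < cycleDist a b → ∃[ c ] C6adj a c ≡ true × suc (cycleDist c b) ≡ cycleDist a b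
  cycleDist-descent = from-yes (all? λ a → all? λ b → 0 <? cycleDist a b →-dec any? λ c →
    C6adj a c Bool.≟ true ×-dec suc (cycleDist c b) ≟ℕ cycleDist a b)

  cycleDist≤3 : ∀ a b → cycleDist a b ≤ 3
  cycleDist≤3 = from-yes (all? λ a → all? λ b → cycleDist a b ≤? 3)

  3≤ᵇcycleDist : ∀ a b → (3 ≤ᵇ cycleDist a b) ≡ does (antipode a ≟ b)
  3≤ᵇcycleDist = from-yes (all? λ a → all? λ b → (3 ≤ᵇ cycleDist a b) Bool.≟ does (antipode a ≟ b))

  cycleDist-antipode : ∀ a → cycleDist a (antipode a) ≡ 3
  cycleDist-antipode = from-yes (all? λ a → cycleDist a (antipode a) ≟ℕ 3)

  module _ {n} {G : Graph n} {d : Fin n → Fin n → ℕ} (isDistance : IsDistance G d) (c6 : IsC6 G) where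
    open Distances isDistance
    open Inverse (proj₁ c6) using (to; from; strictlyInverseˡ; strictlyInverseʳ)

    private
      adj≡C6adj : ∀ i j → adj G i j ≡ C6adj (to i) (to j)
      adj≡C6adj = proj₂ c6

    walk⇒cycleDist-≤ : ∀ {i j ℓ} → Walk G i j ℓ → cycleDist (to i) (to j) ≤ ℓ
    walk⇒cycleDist-≤ (here i) = ≤-reflexive (cycleDist-refl (to i))
    walk⇒cycleDist-≤ {i} {j} (step {j = x} i~x w) =
      ≤-trans (cycleDist-step (to i) (to j) (to x) (trans (sym (adj≡C6adj i x)) i~x)) (s≤s (walk⇒cycleDist-≤ w))

    Adj-from : ∀ {a b} → C6adj a b ≡ true → Adj G (from a) (from b)
    Adj-from {a} {b} a~b = trans (adj≡C6adj (from a) (from b))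
      (subst₂ (λ x y → C6adj x y ≡ true) (sym (strictlyInverseˡ a)) (sym (strictlyInverseˡ b)) a~b)

    cycleDist-walk : ∀ k a b → cycleDist a b ≡ k → Walk G (from a) (from b) k
    cycleDist-walk zero    a b a≡b rewrite cycleDist≡0⇒≡ a b a≡b = here (from b)
    cycleDist-walk (suc k) a b eq with c , a~c , closer ← cycleDist-descent a b (subst (0 <_) (sym eq) z<s) =
      step (Adj-from a~c) (cycleDist-walk k c b (suc-injective (trans closer eq)))

    d≡cycleDist : ∀ i j → d i j ≡ cycleDist (to i) (to j)
    d≡cycleDist i j = ≤-antisym
      (d-≤-walk (subst₂ (λ x y → Walk G x y _) (strictlyInverseʳ i) (strictlyInverseʳ j)
        (cycleDist-walk _ (to i) (to j) refl)))
      (walk⇒cycleDist-≤ (d-walk i j))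

    C6-equalityCase : ∀ {r} → IsRadius d r → EqualityCase d r
    C6-equalityCase {r} ((v , ecc≡r) , _) = d≤3 , λ w → trans (cong (_+ 2) (farCount≡1 w)) (sym r≡3)
      where
      d≤3 : ∀ i j → d i j ≤ 3
      d≤3 i j = subst (_≤ 3) (sym (d≡cycleDist i j)) (cycleDist≤3 (to i) (to j))

      opposite : Fin n → Fin n
      opposite w = from (antipode (to w))

      d-opposite : ∀ w → d w (opposite w) ≡ 3
      d-opposite w = trans (d≡cycleDist w _)
                           (trans (cong (cycleDist (to w)) (strictlyInverseˡ _)) (cycleDist-antipode (to w)))

      farCount≡1 : ∀ w → farCount d w ≡ 1
      farCount≡1 w = trans (sum-map-cong far⇔opposite (allFin n)) (∑-δ (opposite w))
        where
        far⇔opposite : ∀ j → b2n (3 ≤ᵇ d w j) ≡ b2n (does (opposite w ≟ j))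
        far⇔opposite j = cong b2n (begin
          3 ≤ᵇ d w j                     ≡⟨ cong (3 ≤ᵇ_) (d≡cycleDist w j) ⟩
          3 ≤ᵇ cycleDist (to w) (to j)   ≡⟨ 3≤ᵇcycleDist (to w) (to j) ⟩
          does (antipode (to w) ≟ to j)  ≡⟨ does-⇔ (mk⇔ (λ e → trans (cong from e) (strictlyInverseʳ j))
                                                     (λ e → trans (sym (strictlyInverseˡ _)) (cong to e)))
                                               (antipode (to w) ≟ to j) (opposite w ≟ j) ⟩
          does (opposite w ≟ j)          ∎)
          where open ≡-Reasoning

      r≡3 : r ≡ 3
      r≡3 = trans (sym ecc≡r) (≤-antisym (ecc-≤ (d≤3 v)) (subst (_≤ ecc d v) (d-opposite v) (d-≤-ecc v _)))

open import Data.Rational using (_≤_; _*_; _+_; _-_)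

corollary3p4 : ∀ {n} (G : Graph n) (d : Fin n → Fin n → ℕ) (r : ℕ) →
    Connected G → TriangleFree G → QuadrangleFree G →
    IsDistance G d → IsRadius d r →
    (closeness d ≤ (ℕtoℚ n * (ℕtoℚ 2 * ℕtoℚ n - ℕtoℚ r) + ℕtoℚ 4 * ℕtoℚ (edgeCount G)) * oneEighth)
    × (IsMooreDiam2 G d ⊎ IsC6 G →
       closeness d ≡ (ℕtoℚ n * (ℕtoℚ 2 * ℕtoℚ n - ℕtoℚ r) + ℕtoℚ 4 * ℕtoℚ (edgeCount G)) * oneEighth)
corollary3p4 G d r _ _ _ isDistance radius@(_ , r≤ecc) =
    closeness-≤-closenessBound r≤ecc
  , λ where
      (inj₁ moore) → closeness≡closenessBound (moore-equalityCase isDistance radius moore)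
      (inj₂ c6)    → closeness≡closenessBound (C6-equalityCase isDistance c6 radius)
  where open Distances isDistance
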